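{- (1) $\square p\rightarrow p$ modally defines $\mathcal{C}_{\mathbf{uref}}$; (2) $p\rightarrow\lozenge p$ modally defines $\mathcal{C}_{\mathbf{dref}}$; (3) $\lozenge\square p\rightarrow p$ modally defines $\mathcal{C}_{\mathbf{usym}}$; (4) $p\rightarrow\square\lozenge p$ modally defines $\mathcal{C}_{\mathbf{dsym}}$; (5) $\square p\rightarrow\square\square p$ modally defines $\mathcal{C}_{\mathbf{utra}}$; (6) $\lozenge\lozenge p\rightarrow\lozenge p$ modally defines $\mathcal{C}_{\mathbf{dtra}}$.
   Context: Formulas are built from a countably infinite set of atoms by $A::=p\mid (A\rightarrow A)\mid\top\mid\bot\mid(A\vee A)\mid(A\wedge A)\mid\square A\mid\lozenge A$. A frame is a triple $(W,\leq,R)$ with $W$ nonempty, $\leq$ a preorder on $W$, $R$ a binary relation on $W$; $\geq$ is the converse of $\leq$, and $s(S\circ T)t$ means there is $u$ with $sSu$ and $uTt$. A valuation assigns to each atom a $\leq$-upward-closed subset of $W$. Satisfaction: $s\models p$ iff $s\in V(p)$; $s\models A\rightarrow B$ iff for all $t\geq s$, $t\models A$ implies $t\models B$; $\top$ always true, $\bot$ never; $\vee,\wedge$ pointwise; $s\models\square A$ iff $t\models A$ for all $t$ with $s(\leq\circ R)t$; $s\models\lozenge A$ iff there is $t$ with $s(\geq\circ R)t$ and $t\models A$. A formula is valid in a frame if true at every state of every model based on it. A formula $A$ modally defines a class $\mathcal{C}$ of frames if for every frame $F$, $F\in\mathcal{C}$ iff $A$ is valid in $F$. Frame classes: $\mathcal{C}_{\mathbf{uref}}$: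 for all $s$, $s(\leq\circ R\circ\leq)s$; $\mathcal{C}_{\mathbf{dref}}$: for all $s$, $s(\geq\circ R\circ\geq)s$; $\mathcal{C}_{\mathbf{usym}}$: $sRt$ implies $t(\leq\circ R\circ\leq)s$; $\mathcal{C}_{\mathbf{dsym}}$: $sRt$ implies $t(\geq\circ R\circ\geq)s$; $\mathcal{C}_{\mathbf{utra}}$: $sRt$, $t\leq u$, $uRv$ imply $s(\leq\circ R\circ\leq)v$; $\mathcal{C}_{\mathbf{dtra}}$: $sRt$, $t\geq u$, $uRv$ imply $s(\geq\circ R\circ\geq)v$. -}

module Defs where

open import Data.Nat using (ℕ)
open import Data.Product using (Σ; _×_; _,_)
open import Data.Empty using (⊥)
open import Data.Unit using (⊤)
open import Data.Sum using (_⊎_)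
open import Level using (suc; zero)

Atom : Set
Atom = ℕ

data Formula : Set where
  var  : Atom → Formula
  _⇒_  : Formula → Formula → Formula
  ⊤'   : Formula
  ⊥'   : Formula
  _∨'_ : Formula → Formula → Formula
  _∧'_ : Formula → Formula → Formula
  □_   : Formula → Formula
  ◇_   : Formula → Formula

infixr 5 _⇒_
infix 8 □_ ◇_

record Frame : Set₁ where
  field
    W        : Set
    inhabited : W
    _≼_      : W → W → Set
    ≼-refl   : ∀ {s} → s ≼ s
    ≼-trans  : ∀ {s t u} → s ≼ t → t ≼ u → s ≼ u
    R        : W → W → Set

module _ (F : Frame) where
  open Frame F

  ≤R : W → W → Set
  ≤R s t = Σ W λ u → s ≼ u × R u t

  ≥R : W → W → Set
  ≥R s t = Σ W λ u → u ≼ s × R u t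

  ≤R≤ : W → W → Set
  ≤R≤ s t = Σ W λ u → Σ W λ v → s ≼ u × R u v × v ≼ t

  ≥R≥ : W → W → Set
  ≥R≥ s t = Σ W λ u → Σ W λ v → u ≼ s × R u v × t ≼ v

  record Valuation : Set₁ where
    field
      V      : Atom → W → Set
      upward : ∀ p {s t} → s ≼ t → V p s → V p t

  _,_⊨_ : Valuation → W → Formula → Set
  M , s ⊨ var p   = Valuation.V M p s
  M , s ⊨ (A ⇒ B) = ∀ t → s ≼ t → M , t ⊨ A → M , t ⊨ B
  M , s ⊨ ⊤'      = ⊤
  M , s ⊨ ⊥'      = ⊥
  M , s ⊨ (A ∨' B) = (M , s ⊨ A) ⊎ (M , s ⊨ B)
  M , s ⊨ (A ∧' B) = (M , s ⊨ A) × (M , s ⊨ B)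
  M , s ⊨ (□ A)   = ∀ t → ≤R s t → M , t ⊨ A
  M , s ⊨ (◇ A)   = Σ W λ t → ≥R s t × M , t ⊨ A

ValidIn : Formula → Frame → Set₁
ValidIn A F = ∀ (M : Valuation F) (s : Frame.W F) → _,_⊨_ F M s A

Uref Dref Usym Dsym Utra Dtra : Frame → Set
Uref F = ∀ s → ≤R≤ F s s where open Frame F
Dref F = ∀ s → ≥R≥ F s s where open Frame F
Usym F = ∀ s t → R s t → ≤R≤ F t s where open Frame F
Dsym F = ∀ s t → R s t → ≥R≥ F t s where open Frame F
Utra F = ∀ s t u v → R s t → t ≼ u → R u v → ≤R≤ F s v where open Frame F
Dtra F = ∀ s t u v → R s t → u ≼ t → R u v → ≥R≥ F s v where open Frame F

Defines : Formula → (Frame → Set) → Set₁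
Defines A C = ∀ (F : Frame) → (C F → ValidIn A F) × (ValidIn A F → C F)

p : Formula
p = var 0

-- Soundness of each axiom is a direct unfolding of the frame condition, transporting p
-- along ≤ by upward closure. For completeness, evaluate the axiom under the least
-- valuation making its antecedent true: p ↦ {x | s (≤∘R∘≤) x} when the antecedent is □p,
-- p ↦ {x | v ≤ x} when the antecedent is p or ◇◇p. The consequent then says exactly
-- that the frame condition holds.
module Submission where

open import Defs
open import Data.Product using (_×_; _,_)

module _ (F : Frame) where
  open Frame F
  open Valuation using (upward)

  ⇒-valid : ∀ A B → (∀ M s → _,_⊨_ F M s A → _,_⊨_ F M s B) → ValidIn (A ⇒ B) F
  ⇒-valid _ _ A→B M _ t _ = A→B M t

  ⇒-valid⁻¹ : ∀ A B → ValidIn (A ⇒ B) F → ∀ M s → _,_⊨_ F M s A → _,_⊨_ F M s B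
  ⇒-valid⁻¹ _ _ valid M s = valid M s s ≼-refl

  R⇒≤R : ∀ {s t} → R s t → ≤R F s t
  R⇒≤R r = _ , ≼-refl , r

  R⇒≥R : ∀ {s t} → R s t → ≥R F s t
  R⇒≥R r = _ , ≼-refl , r

  ≤R⇒≤R≤ : ∀ {s t} → ≤R F s t → ≤R≤ F s t
  ≤R⇒≤R≤ (u , su , r) = u , _ , su , r , ≼-refl

  ≤R≤-closedʳ : ∀ {s t t′} → t ≼ t′ → ≤R≤ F s t → ≤R≤ F s t′
  ≤R≤-closedʳ tt′ (u , v , su , r , vt) = u , v , su , r , ≼-trans vt tt′

  upsetValuation : (X : W → Set) → (∀ {s t} → s ≼ t → X s → X t) → Valuation F
  upsetValuation X closed = record { V = λ _ → X ; upward = λ _ → closed }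

  principal : W → Valuation F
  principal v = upsetValuation (v ≼_) (λ st vs → ≼-trans vs st)

  successors : W → Valuation F
  successors s = upsetValuation (≤R≤ F s) ≤R≤-closedʳ

  successors-⊨-□p : ∀ s → _,_⊨_ F (successors s) s (□ p)
  successors-⊨-□p s t st = ≤R⇒≤R≤ st

  principal-⊨-◇p⇒≥R≥ : ∀ {s v} → _,_⊨_ F (principal v) s (◇ p) → ≥R≥ F s v
  principal-⊨-◇p⇒≥R≥ (t , (u , us , r) , vt) = u , t , us , r , vt

  uref-sound : Uref F → ValidIn (□ p ⇒ p) F
  uref-sound uref = ⇒-valid (□ p) p λ M s □ps → sound M s □ps (uref s)
    where
    sound : ∀ M s → _,_⊨_ F M s (□ p) → ≤R≤ F s s → _,_⊨_ F M s p
    sound M s □ps (u , v , su , r , vs) = upward M 0 vs (□ps v (u , su , r))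

  uref-complete : ValidIn (□ p ⇒ p) F → Uref F
  uref-complete valid s =
    ⇒-valid⁻¹ (□ p) p valid (successors s) s (successors-⊨-□p s)

  dref-sound : Dref F → ValidIn (p ⇒ ◇ p) F
  dref-sound dref = ⇒-valid p (◇ p) λ M s ps → sound M s ps (dref s)
    where
    sound : ∀ M s → _,_⊨_ F M s p → ≥R≥ F s s → _,_⊨_ F M s (◇ p)
    sound M s ps (u , v , us , r , sv) = v , (u , us , r) , upward M 0 sv ps

  dref-complete : ValidIn (p ⇒ ◇ p) F → Dref F
  dref-complete valid s =
    principal-⊨-◇p⇒≥R≥ (⇒-valid⁻¹ p (◇ p) valid (principal s) s ≼-refl)

  usym-sound : Usym F → ValidIn (◇ □ p ⇒ p) F
  usym-sound usym = ⇒-valid (◇ □ p) p sound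
    where
    sound : ∀ M s → _,_⊨_ F M s (◇ □ p) → _,_⊨_ F M s p
    sound M s (v , (u , us , r) , □pv) with usym u v r
    ... | a , b , va , r′ , bu = upward M 0 (≼-trans bu us) (□pv b (a , va , r′))

  usym-complete : ValidIn (◇ □ p ⇒ p) F → Usym F
  usym-complete valid s t r =
    ⇒-valid⁻¹ (◇ □ p) p valid (successors t) s (t , R⇒≥R r , successors-⊨-□p t)

  dsym-sound : Dsym F → ValidIn (p ⇒ □ ◇ p) F
  dsym-sound dsym = ⇒-valid p (□ ◇ p) sound
    where
    sound : ∀ M s → _,_⊨_ F M s p → _,_⊨_ F M s (□ ◇ p)
    sound M s ps v (u , su , r) with dsym u v r
    ... | a , b , av , r′ , ub = b , (a , av , r′) , upward M 0 (≼-trans su ub) ps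

  dsym-complete : ValidIn (p ⇒ □ ◇ p) F → Dsym F
  dsym-complete valid s t r =
    principal-⊨-◇p⇒≥R≥ (⇒-valid⁻¹ p (□ ◇ p) valid (principal s) s ≼-refl t (R⇒≤R r))

  utra-sound : Utra F → ValidIn (□ p ⇒ □ □ p) F
  utra-sound utra = ⇒-valid (□ p) (□ □ p) sound
    where
    sound : ∀ M s → _,_⊨_ F M s (□ p) → _,_⊨_ F M s (□ □ p)
    sound M s □ps b (a , sa , r) d (c , bc , r′) with utra a b c d r bc r′
    ... | e , f , ae , r″ , fd = upward M 0 fd (□ps f (e , ≼-trans sa ae , r″))

  utra-complete : ValidIn (□ p ⇒ □ □ p) F → Utra F
  utra-complete valid s t u v r tu r′ =
    ⇒-valid⁻¹ (□ p) (□ □ p) valid (successors s) s (successors-⊨-□p s)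
      t (R⇒≤R r) v (u , tu , r′)

  dtra-sound : Dtra F → ValidIn (◇ ◇ p ⇒ ◇ p) F
  dtra-sound dtra = ⇒-valid (◇ ◇ p) (◇ p) sound
    where
    sound : ∀ M s → _,_⊨_ F M s (◇ ◇ p) → _,_⊨_ F M s (◇ p)
    sound M s (a , (b , bs , r) , c , (d , da , r′) , pc) with dtra b a d c r da r′
    ... | e , f , eb , r″ , cf = f , (e , ≼-trans eb bs , r″) , upward M 0 cf pc

  dtra-complete : ValidIn (◇ ◇ p ⇒ ◇ p) F → Dtra F
  dtra-complete valid s t u v r ut r′ = principal-⊨-◇p⇒≥R≥
    (⇒-valid⁻¹ (◇ ◇ p) (◇ p) valid (principal v) s
      (t , R⇒≥R r , v , (u , ut , r′) , ≼-refl))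

mainTheorem14 : Defines (□ p ⇒ p) Uref
    × Defines (p ⇒ ◇ p) Dref
    × Defines (◇ □ p ⇒ p) Usym
    × Defines (p ⇒ □ ◇ p) Dsym
    × Defines (□ p ⇒ □ □ p) Utra
    × Defines (◇ ◇ p ⇒ ◇ p) Dtra
mainTheorem14 =
    (λ F → uref-sound F , uref-complete F)
  , (λ F → dref-sound F , dref-complete F)
  , (λ F → usym-sound F , usym-complete F)
  , (λ F → dsym-sound F , dsym-complete F)
  , (λ F → utra-sound F , utra-complete F)
  , (λ F → dtra-sound F , dtra-complete F)
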